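{- Let $L=(U,F,H)$ be a connected pseudograph whose normal subgraph $(U,F)$ is a tree, and let $n=|U|$ and $k=|H|$. Then (1) the number of valid orientations of $L$ is either $0$ or $1$; and (2) if $L$ has a valid orientation, then $k=n+1$.
   Context: A pseudograph $L=(U,F,H)$ consists of a finite set $U$ of vertices, a finite set $F$ of normal edges, each incident to two vertices of $U$, and a finite set $H$ of hanging edges, each having a single endpoint in $U$ and always directed out of that endpoint. The normal subgraph is the graph $(U,F)$; $L$ is connected if its normal subgraph is connected. An orientation of $L$ assigns a direction to every normal edge; the outdegree of a vertex counts all normal and hanging edges directed out of it. An orientation is valid if every vertex of $U$ has outdegree exactly $2$. -}

module Defs where

open import Data.Nat using (ℕ; zero; suc; _+_; _≥_)
open import Data.Fin using (Fin; _≟_)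
open import Data.Fin.Properties using (all?)
open import Data.Bool using (Bool; true; false)
open import Data.List using (List; []; _∷_; map; _++_; length; filter)
open import Data.Nat.ListAction using (sum)
open import Data.List.Relation.Unary.Unique.Propositional using (Unique)
open import Data.Product using (Σ; ∃; _×_; _,_)
open import Relation.Binary.PropositionalEquality using (_≡_)
open import Relation.Nullary using (¬_; Dec; yes; no)
open import Data.Nat using () renaming (_≟_ to _≟ℕ_)

-- A pseudograph with vertex set Fin n, normal edges Fin m (edge e joins
-- end₁ e and end₂ e) and hanging edges Fin k (hanging edge h sits at hang h).
record Pseudograph (n m k : ℕ) : Set where
  field
    end₁ : Fin m → Fin n
    end₂ : Fin m → Fin n
    hang : Fin k → Fin n

module _ {n m k : ℕ} (L : Pseudograph n m k) where
  open Pseudograph L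

  from : Fin m → Bool → Fin n
  from e true  = end₁ e
  from e false = end₂ e

  to : Fin m → Bool → Fin n
  to e true  = end₂ e
  to e false = end₁ e

  data Walk : Fin n → Fin n → Set where
    [] : ∀ {v} → Walk v v
    step : ∀ {v} (e : Fin m) (b : Bool) → Walk (to e b) v → Walk (from e b) v

  walkEdges : ∀ {u v} → Walk u v → List (Fin m)
  walkEdges [] = []
  walkEdges (step e b w) = e ∷ walkEdges w

  walkLaterVertices : ∀ {u v} → Walk u v → List (Fin n)
  walkLaterVertices [] = []
  walkLaterVertices (step e b w) = to e b ∷ walkLaterVertices w

  IsCycle : ∀ {v} → Walk v v → Set
  IsCycle w = length (walkEdges w) ≥ 1
            × Unique (walkEdges w) × Unique (walkLaterVertices w)

  -- connected (a connected graph is nonempty)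
  Connected : Set
  Connected = n ≥ 1 × (∀ u v → Walk u v)

  Acyclic : Set
  Acyclic = ∀ v (w : Walk v v) → ¬ IsCycle w

  NormalIsTree : Set
  NormalIsTree = Connected × Acyclic

  -- orientation: o e = true means e is directed end₁ → end₂
  Orientation : Set
  Orientation = Fin m → Bool

  allFins : (j : ℕ) → List (Fin j)
  allFins zero = []
  allFins (suc j) = Fin.zero ∷ map Fin.suc (allFins j)
    where import Data.Fin as Fin

  indicator : ∀ {A : Set} → Dec A → ℕ
  indicator (yes _) = 1
  indicator (no _)  = 0

  outdeg : Orientation → Fin n → ℕ
  outdeg o v = sum (map (λ e → indicator (from e (o e) ≟ v)) (allFins m))
             + sum (map (λ h → indicator (hang h ≟ v)) (allFins k))

  Valid : Orientation → Set
  Valid o = ∀ v → outdeg o v ≡ 2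

  valid? : (o : Orientation) → Dec (Valid o)
  valid? o = all? (λ v → outdeg o v ≟ℕ 2)

allOrientations : (j : ℕ) → List (Fin j → Bool)
allOrientations zero = (λ ()) ∷ []
allOrientations (suc j) =
  map (λ f → λ { Fin.zero → true ; (Fin.suc i) → f i }) (allOrientations j)
  ++ map (λ f → λ { Fin.zero → false ; (Fin.suc i) → f i }) (allOrientations j)
  where import Data.Fin as Fin

numValid : ∀ {n m k} → Pseudograph n m k → ℕ
numValid {m = m} L = length (filter (valid? L) (allOrientations m))

{-# OPTIONS --safe #-}
-- If every vertex is reachable from a set R of roots, then after deleting an edge it is
-- reachable from R plus at most one new root; if the graph is a forest and R has one root
-- in each of some distinct components, deleting an edge splits a component and leaves room
-- for one more root.  By induction on the edges, n ≤ m + |R| in the first situation and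
-- m + |R| ≤ n in the second, so a tree has n = m + 1.  Summing outdegrees counts each
-- normal and hanging edge once, so a valid orientation gives 2n = m + k.  If two valid
-- orientations o and o′ disagree, every vertex has as many disagreeing edges leaving it
-- under o as entering it, so following them yields arbitrarily long o-directed walks; in
-- an acyclic graph these never revisit a vertex, which is impossible beyond n steps.
module Submission where

open import Defs
open import Data.Bool using (Bool; true; false)
open import Data.Bool.Properties using () renaming (_≟_ to _≟ᵇ_)
open import Data.Empty using (⊥-elim)
open import Data.Fin using (Fin; zero; suc; _≟_)
import Data.Fin as Fin
open import Data.Fin.Properties using (pigeonhole; <⇒≢; any?; suc-injective)
open import Data.List using (List; []; _∷_; map; length; filter; lookup)
open import Data.List.Properties using (map-∘; length-map; filter-none)
open import Data.List.Membership.Propositional using (_∈_; _∉_)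
open import Data.List.Membership.Propositional.Properties using (∈-lookup)
open import Data.List.Relation.Unary.All as All using (All; []; _∷_)
open import Data.List.Relation.Unary.All.Properties using (¬Any⇒All¬; All¬⇒¬Any)
open import Data.List.Relation.Unary.AllPairs as AllPairs using (AllPairs; []; _∷_)
import Data.List.Relation.Unary.AllPairs.Properties as AllPairsₚ
import Data.List.Relation.Unary.All.Properties as Allₚ
open import Data.List.Relation.Unary.Any using (here; there; index)
open import Data.List.Relation.Unary.Any.Properties using (lookup-index)
open import Data.List.Relation.Unary.Unique.Propositional using (Unique)
import Data.List.Relation.Unary.Unique.Propositional.Properties as Uniqueₚ
open import Data.Nat using (ℕ; zero; suc; _+_; _*_; _≤_; _<_; _≤?_; z≤n; s≤s)
open import Data.Nat.ListAction using (sum)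
open import Data.Nat.Properties
  using ( +-0-commutativeMonoid; +-suc; +-cancelˡ-≡; +-cancelʳ-≡; *-zeroʳ; *-identityʳ
        ; ≤-antisym; ≤-trans; ≤-reflexive; ≮⇒≥; <-irrefl; 1+n≰n; m≤n⇒m≤1+n
        ; +-mono-≤; +-mono-<-≤; +-mono-≤-<; n<1⇒n≡0; m≤n⇒m<n∨m≡n)
open import Data.Nat.Tactic.RingSolver using (solve-∀)
open import Data.Product using (Σ; ∃; ∃-syntax; _×_; _,_)
open import Data.Sum using (_⊎_; inj₁; inj₂)
import Data.Sum as Sum
open import Data.Unit using (⊤; tt)
open import Function using (_∘_)
open import Relation.Nullary using (¬_; Dec; yes; no; does; contradiction)
open import Relation.Nullary.Decidable using (decidable-stable; ¬¬-excluded-middle; ¬?; _×-dec_)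
open import Relation.Unary using (Decidable)
open import Relation.Binary.PropositionalEquality
open import Algebra.Properties.CommutativeMonoid.Sum +-0-commutativeMonoid
  using (sum-syntax; ∑-comm; ∑-distrib-+; sum-cong-≗)

lookup-injective : ∀ {A : Set} {xs : List A} → Unique xs →
                   ∀ {i j} → lookup xs i ≡ lookup xs j → i ≡ j
lookup-injective (_  ∷ _) {zero}  {zero}  _  = refl
lookup-injective (x∉ ∷ _) {zero}  {suc j} eq = contradiction eq (All.lookup x∉ (∈-lookup j))
lookup-injective (x∉ ∷ _) {suc i} {zero}  eq = contradiction (sym eq) (All.lookup x∉ (∈-lookup i))
lookup-injective (_  ∷ u) {suc i} {suc j} eq = cong suc (lookup-injective u eq)

Unique⇒length≤ : ∀ {n} {xs : List (Fin n)} → Unique xs → length xs ≤ n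
Unique⇒length≤ {xs = xs} xs! = ≮⇒≥ λ n<len →
  let i , j , i<j , xsᵢ≡xsⱼ = pigeonhole n<len (lookup xs)
  in <⇒≢ i<j (lookup-injective xs! xsᵢ≡xsⱼ)

complete⇒length≥ : ∀ {n} {xs : List (Fin n)} → (∀ v → v ∈ xs) → n ≤ length xs
complete⇒length≥ {xs = xs} v∈ = ≮⇒≥ λ len<n →
  let i , j , i<j , eq = pigeonhole len<n (index ∘ v∈)
  in <⇒≢ i<j (begin
       i                         ≡⟨ lookup-index (v∈ i) ⟩
       lookup xs (index (v∈ i))  ≡⟨ cong (lookup xs) eq ⟩
       lookup xs (index (v∈ j))  ≡⟨ lookup-index (v∈ j) ⟨
       j                         ∎)
  where open ≡-Reasoning

zero∉map-suc : ∀ {j} (xs : List (Fin j)) → Fin.zero ∉ map Fin.suc xs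
zero∉map-suc (_ ∷ xs) (here ())
zero∉map-suc (_ ∷ xs) (there zero∈) = zero∉map-suc xs zero∈

module _ {n m k : ℕ} {L : Pseudograph n m k} where
  open import Data.List.Membership.DecPropositional (_≟_ {n}) using (_∈?_)

  vertices : ∀ {u v} → Walk L u v → List (Fin n)
  vertices {u} w = u ∷ walkLaterVertices L w

  infixr 5 _++ʷ_
  _++ʷ_ : ∀ {u v x} → Walk L u v → Walk L v x → Walk L u x
  []         ++ʷ w′ = w′
  step e b w ++ʷ w′ = step e b (w ++ʷ w′)

  traverseBack : ∀ e b → Walk L (to L e b) (from L e b)
  traverseBack e true  = step e false []
  traverseBack e false = step e true []

  reverse : ∀ {u v} → Walk L u v → Walk L v u
  reverse []           = []
  reverse (step e b w) = reverse w ++ʷ traverseBack e b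

  end∈vertices : ∀ {u v} (w : Walk L u v) → v ∈ vertices w
  end∈vertices []           = here refl
  end∈vertices (step e b w) = there (end∈vertices w)

  prefix : ∀ {u v x} (w : Walk L u v) → x ∈ vertices w → Walk L u x
  prefix w            (here refl) = []
  prefix []           (there ())
  prefix (step e b w) (there x∈)  = step e b (prefix w x∈)

  suffix : ∀ {u v x} (w : Walk L u v) → x ∈ vertices w → Walk L x v
  suffix w            (here refl) = w
  suffix []           (there ())
  suffix (step e b w) (there x∈)  = suffix w x∈

  prefix-⊆ : ∀ {u v x y} (w : Walk L u v) (x∈ : x ∈ vertices w) →
             y ∈ vertices (prefix w x∈) → y ∈ vertices w
  prefix-⊆ w            (here refl) (here y≡u)  = here y≡u
  prefix-⊆ []           (there ())  _
  prefix-⊆ (step e b w) (there x∈)  (here y≡u)  = here y≡u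
  prefix-⊆ (step e b w) (there x∈)  (there y∈)  = there (prefix-⊆ w x∈ y∈)

  prefix-Unique : ∀ {u v x} (w : Walk L u v) (x∈ : x ∈ vertices w) →
                  Unique (vertices w) → Unique (vertices (prefix w x∈))
  prefix-Unique w            (here refl) _           = [] ∷ []
  prefix-Unique []           (there ())  _
  prefix-Unique (step e b w) (there x∈)  (u∉ ∷ w!) =
    ¬Any⇒All¬ _ (All¬⇒¬Any u∉ ∘ prefix-⊆ w x∈) ∷ prefix-Unique w x∈ w!

  suffix-Unique : ∀ {u v x} (w : Walk L u v) (x∈ : x ∈ vertices w) →
                  Unique (vertices w) → Unique (vertices (suffix w x∈))
  suffix-Unique w            (here refl) w!       = w!
  suffix-Unique []           (there ())  _
  suffix-Unique (step e b w) (there x∈)  (_ ∷ w!) = suffix-Unique w x∈ w!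

  toPath : ∀ {u v} → Walk L u v → Σ (Walk L u v) (λ p → Unique (vertices p))
  toPath [] = [] , [] ∷ []
  toPath (step e b w) with toPath w
  ... | p , p! with from L e b ∈? vertices p
  ...   | yes u∈ = suffix p u∈ , suffix-Unique p u∈ p!
  ...   | no  u∉ = step e b p , ¬Any⇒All¬ _ u∉ ∷ p!

  endpoints∈vertices : ∀ {u v f} (w : Walk L u v) → f ∈ walkEdges L w →
                       ∀ c → from L f c ∈ vertices w
  endpoints∈vertices (step e true  w) (here refl) true  = here refl
  endpoints∈vertices (step e true  w) (here refl) false = there (here refl)
  endpoints∈vertices (step e false w) (here refl) true  = there (here refl)
  endpoints∈vertices (step e false w) (here refl) false = here refl
  endpoints∈vertices (step e b     w) (there f∈)  c     = there (endpoints∈vertices w f∈ c)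

  Unique-vertices⇒Unique-edges : ∀ {u v} (w : Walk L u v) →
                                 Unique (vertices w) → Unique (walkEdges L w)
  Unique-vertices⇒Unique-edges []           _          = []
  Unique-vertices⇒Unique-edges (step e b w) (u∉ ∷ w!) =
    ¬Any⇒All¬ _ (λ e∈ → All¬⇒¬Any u∉ (endpoints∈vertices w e∈ b))
      ∷ Unique-vertices⇒Unique-edges w w!

  closing-isCycle : ∀ e b (p : Walk L (to L e b) (from L e b)) →
                    Unique (vertices p) → e ∉ walkEdges L p → IsCycle L (step e b p)
  closing-isCycle e b p p! e∉ =
    s≤s z≤n , ¬Any⇒All¬ _ e∉ ∷ Unique-vertices⇒Unique-edges p p! , p!

Reachable : ∀ {n m k} → Pseudograph n m k → List (Fin n) → Fin n → Set
Reachable L R v = ∃[ r ] r ∈ R × Walk L r v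

Covers : ∀ {n m k} → Pseudograph n m k → List (Fin n) → Set
Covers L R = ∀ v → Reachable L R v

Separated : ∀ {n m k} → Pseudograph n m k → List (Fin n) → Set
Separated L R = Unique R × (∀ {r r′} → r ∈ R → r′ ∈ R → Walk L r r′ → r ≡ r′)

deleteEdge₀ : ∀ {n m k} → Pseudograph n (suc m) k → Pseudograph n m k
deleteEdge₀ L = record { end₁ = end₁ ∘ suc ; end₂ = end₂ ∘ suc ; hang = hang }
  where open Pseudograph L

module EdgeDeletion {n m k : ℕ} (L : Pseudograph n (suc m) k) where

  L⁻ : Pseudograph n m k
  L⁻ = deleteEdge₀ L

  x₀ y₀ : Fin n
  x₀ = Pseudograph.end₁ L zero
  y₀ = Pseudograph.end₂ L zero

  lift : ∀ {u v} → Walk L⁻ u v → Walk L u v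
  lift []               = []
  lift (step e true  w) = step (suc e) true  (lift w)
  lift (step e false w) = step (suc e) false (lift w)

  lift-edges : ∀ {u v} (w : Walk L⁻ u v) → walkEdges L (lift w) ≡ map suc (walkEdges L⁻ w)
  lift-edges []               = refl
  lift-edges (step e true  w) = cong (suc e ∷_) (lift-edges w)
  lift-edges (step e false w) = cong (suc e ∷_) (lift-edges w)

  lift-later : ∀ {u v} (w : Walk L⁻ u v) → walkLaterVertices L (lift w) ≡ walkLaterVertices L⁻ w
  lift-later []               = refl
  lift-later (step e true  w) = cong (_ ∷_) (lift-later w)
  lift-later (step e false w) = cong (_ ∷_) (lift-later w)

  lift-Unique : ∀ {u v} (w : Walk L⁻ u v) → Unique (vertices w) → Unique (vertices (lift w))
  lift-Unique {u} w = subst (λ vs → Unique (u ∷ vs)) (sym (lift-later w))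

  zero∉lift : ∀ {u v} (w : Walk L⁻ u v) → Fin.zero ∉ walkEdges L (lift w)
  zero∉lift w = zero∉map-suc _ ∘ subst (Fin.zero ∈_) (lift-edges w)

  lift-isCycle : ∀ {v} (w : Walk L⁻ v v) → IsCycle L⁻ w → IsCycle L (lift w)
  lift-isCycle w (nonempty , edges! , later!) =
      subst (λ es → 1 ≤ length es) (sym (lift-edges w))
            (subst (1 ≤_) (sym (length-map Fin.suc (walkEdges L⁻ w))) nonempty)
    , subst Unique (sym (lift-edges w)) (Uniqueₚ.map⁺ suc-injective edges!)
    , subst Unique (sym (lift-later w)) later!

  acyclic⁻ : Acyclic L → Acyclic L⁻
  acyclic⁻ acyclic v w = acyclic v (lift w) ∘ lift-isCycle w

  lastUse₀ : ∀ {u v} → Walk L u v → Walk L⁻ u v ⊎ ∃[ b ] Walk L⁻ (to L zero b) v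
  lastUse₀ [] = inj₁ []
  lastUse₀ (step e b w) with lastUse₀ w
  ... | inj₂ after = inj₂ after
  lastUse₀ (step zero    b     w) | inj₁ w⁻ = inj₂ (b , w⁻)
  lastUse₀ (step (suc e) true  w) | inj₁ w⁻ = inj₁ (step e true  w⁻)
  lastUse₀ (step (suc e) false w) | inj₁ w⁻ = inj₁ (step e false w⁻)

  firstUse₀ : ∀ {u v} → Walk L u v → Walk L⁻ u v ⊎ ∃[ b ] Walk L⁻ u (from L zero b)
  firstUse₀ [] = inj₁ []
  firstUse₀ (step zero b w) = inj₂ (b , [])
  firstUse₀ (step (suc e) true w) with firstUse₀ w
  ... | inj₁ w⁻       = inj₁ (step e true w⁻)
  ... | inj₂ (c , w⁻) = inj₂ (c , step e true w⁻)
  firstUse₀ (step (suc e) false w) with firstUse₀ w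
  ... | inj₁ w⁻       = inj₁ (step e false w⁻)
  ... | inj₂ (c , w⁻) = inj₂ (c , step e false w⁻)

  covers⁻ : ∀ {R} → Covers L R →
            ¬ ¬ (Covers L⁻ (y₀ ∷ R) ⊎ Covers L⁻ (x₀ ∷ R) ⊎ Covers L⁻ R)
  covers⁻ {R} cover ¬covers⁻ =
    ¬¬-excluded-middle {A = Reachable L⁻ R x₀} λ where
      (yes x₀↝) → ¬covers⁻ (inj₁ (rootAt-y₀ x₀↝))
      (no  x₀↛) → ¬¬-excluded-middle {A = Reachable L⁻ R y₀} λ where
        (yes y₀↝) → ¬covers⁻ (inj₂ (inj₁ (rootAt-x₀ y₀↝)))
        (no  y₀↛) → ¬covers⁻ (inj₂ (inj₂ (unrooted x₀↛ y₀↛)))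
    where
    rootAt-y₀ : Reachable L⁻ R x₀ → Covers L⁻ (y₀ ∷ R)
    rootAt-y₀ (r , r∈ , r↝x₀) v with cover v
    ... | r′ , r′∈ , w with lastUse₀ w
    ...   | inj₁ w⁻          = r′ , there r′∈ , w⁻
    ...   | inj₂ (true  , w⁻) = y₀ , here refl , w⁻
    ...   | inj₂ (false , w⁻) = r , there r∈ , r↝x₀ ++ʷ w⁻
    rootAt-x₀ : Reachable L⁻ R y₀ → Covers L⁻ (x₀ ∷ R)
    rootAt-x₀ (r , r∈ , r↝y₀) v with cover v
    ... | r′ , r′∈ , w with lastUse₀ w
    ...   | inj₁ w⁻          = r′ , there r′∈ , w⁻
    ...   | inj₂ (false , w⁻) = x₀ , here refl , w⁻
    ...   | inj₂ (true  , w⁻) = r , there r∈ , r↝y₀ ++ʷ w⁻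
    unrooted : ¬ Reachable L⁻ R x₀ → ¬ Reachable L⁻ R y₀ → Covers L⁻ R
    unrooted x₀↛ y₀↛ v with cover v
    ... | r , r∈ , w with firstUse₀ w
    ...   | inj₁ w⁻          = r , r∈ , w⁻
    ...   | inj₂ (true  , w⁻) = contradiction (r , r∈ , w⁻) x₀↛
    ...   | inj₂ (false , w⁻) = contradiction (r , r∈ , w⁻) y₀↛

  no-walk-y₀x₀ : Acyclic L → ¬ Walk L⁻ y₀ x₀
  no-walk-y₀x₀ acyclic w =
    let p , p! = toPath w
    in acyclic x₀ (step Fin.zero true (lift p))
         (closing-isCycle Fin.zero true (lift p) (lift-Unique p p!) (zero∉lift p))

  separated-∷ : ∀ {R z} → Separated L R → ¬ Reachable L⁻ R z → Separated L⁻ (z ∷ R)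
  separated-∷ {R} {z} (R! , R-apart) z↛ = ¬Any⇒All¬ _ (λ z∈ → z↛ (z , z∈ , [])) ∷ R! , apart
    where
    apart : ∀ {r r′} → r ∈ z ∷ R → r′ ∈ z ∷ R → Walk L⁻ r r′ → r ≡ r′
    apart (here refl) (here refl) _ = refl
    apart (here refl) (there r′∈) w = contradiction (_ , r′∈ , reverse w) z↛
    apart (there r∈)  (here refl) w = contradiction (_ , r∈ , w) z↛
    apart (there r∈)  (there r′∈) w = R-apart r∈ r′∈ (lift w)

  separated⁻ : ∀ {R} → Acyclic L → Separated L R →
               ¬ ¬ (Separated L⁻ (x₀ ∷ R) ⊎ Separated L⁻ (y₀ ∷ R))
  separated⁻ {R} acyclic separated@(_ , R-apart) ¬separated⁻ =
    ¬¬-excluded-middle {A = Reachable L⁻ R x₀} λ where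
      (no  x₀↛) → ¬separated⁻ (inj₁ (separated-∷ separated x₀↛))
      (yes x₀↝) → ¬¬-excluded-middle {A = Reachable L⁻ R y₀} λ where
        (no  y₀↛) → ¬separated⁻ (inj₂ (separated-∷ separated y₀↛))
        (yes y₀↝) → not-both x₀↝ y₀↝
    where
    -- Edge 0 joins the roots of x₀ and y₀, so they coincide and y₀ ↝ x₀ avoids edge 0.
    not-both : Reachable L⁻ R x₀ → ¬ Reachable L⁻ R y₀
    not-both (r , r∈ , r↝x₀) (r′ , r′∈ , r′↝y₀)
      with R-apart r∈ r′∈ (lift r↝x₀ ++ʷ step Fin.zero true (lift (reverse r′↝y₀)))
    ... | refl = no-walk-y₀x₀ acyclic (reverse r′↝y₀ ++ʷ r↝x₀)

walk-without-edges : ∀ {n k} {L : Pseudograph n 0 k} {u v} → Walk L u v → u ≡ v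
walk-without-edges []            = refl
walk-without-edges (step () _ _)

n≤edges+roots : ∀ {n m k} (L : Pseudograph n m k) {R} → Covers L R → n ≤ m + length R
n≤edges+roots {m = zero} L {R} cover =
  complete⇒length≥ λ v → let r , r∈ , w = cover v in subst (_∈ R) (walk-without-edges w) r∈
n≤edges+roots {n} {suc m} L {R} cover =
  decidable-stable (n ≤? suc m + length R) λ n≰ → covers⁻ cover λ where
    (inj₁ c)        → n≰ (≤-trans (n≤edges+roots L⁻ c) (≤-reflexive (+-suc m _)))
    (inj₂ (inj₁ c)) → n≰ (≤-trans (n≤edges+roots L⁻ c) (≤-reflexive (+-suc m _)))
    (inj₂ (inj₂ c)) → n≰ (m≤n⇒m≤1+n (n≤edges+roots L⁻ c))
  where open EdgeDeletion L

edges+roots≤n : ∀ {n m k} (L : Pseudograph n m k) {R} → Acyclic L → Separated L R → m + length R ≤ n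
edges+roots≤n {m = zero} L acyclic (R! , _) = Unique⇒length≤ R!
edges+roots≤n {n} {suc m} L {R} acyclic separated =
  decidable-stable (suc m + length R ≤? n) λ ≰n → separated⁻ acyclic separated λ where
    (inj₁ s) → ≰n (≤-trans (≤-reflexive (sym (+-suc m _))) (edges+roots≤n L⁻ (acyclic⁻ acyclic) s))
    (inj₂ s) → ≰n (≤-trans (≤-reflexive (sym (+-suc m _))) (edges+roots≤n L⁻ (acyclic⁻ acyclic) s))
  where open EdgeDeletion L

tree⇒vertices≡edges+1 : ∀ {n m k} (L : Pseudograph n m k) → NormalIsTree L → n ≡ m + 1
tree⇒vertices≡edges+1 {zero}  L ((() , _) , _)
tree⇒vertices≡edges+1 {suc n} L ((_ , connected) , acyclic) =
  ≤-antisym (n≤edges+roots L {R = zero ∷ []} (λ v → zero , here refl , connected zero v))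
            (edges+roots≤n L {R = zero ∷ []} acyclic
              ([] ∷ [] , λ { (here refl) (here refl) _ → refl }))

∑-const : ∀ j c → ∑[ i < j ] c ≡ j * c
∑-const zero    c = refl
∑-const (suc j) c = cong (c +_) (∑-const j c)

∑-mono-≤ : ∀ {j} {f g : Fin j → ℕ} → (∀ i → f i ≤ g i) → ∑[ i < j ] f i ≤ ∑[ i < j ] g i
∑-mono-≤ {zero}  f≤g = z≤n
∑-mono-≤ {suc j} f≤g = +-mono-≤ (f≤g zero) (∑-mono-≤ (f≤g ∘ suc))

∑-mono-< : ∀ {j} {f g : Fin j → ℕ} → (∀ i → f i ≤ g i) →
           ∀ i → f i < g i → ∑[ i < j ] f i < ∑[ i < j ] g i
∑-mono-< f≤g zero    fᵢ<gᵢ = +-mono-<-≤ fᵢ<gᵢ (∑-mono-≤ (f≤g ∘ suc))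
∑-mono-< f≤g (suc i) fᵢ<gᵢ = +-mono-≤-< (f≤g zero) (∑-mono-< (f≤g ∘ suc) i fᵢ<gᵢ)

module Outdegree {n m k : ℕ} (L : Pseudograph n m k) where
  open Pseudograph L

  indicator-yes : ∀ {A : Set} (a? : Dec A) → A → indicator L a? ≡ 1
  indicator-yes (yes _) _ = refl
  indicator-yes (no ¬a) a = contradiction a ¬a

  indicator-no : ∀ {A : Set} (a? : Dec A) → ¬ A → indicator L a? ≡ 0
  indicator-no (yes a) ¬a = contradiction a ¬a
  indicator-no (no _)  _  = refl

  indicator-does : ∀ {A B : Set} (a? : Dec A) (b? : Dec B) → does a? ≡ does b? →
                   indicator L a? ≡ indicator L b?
  indicator-does (yes _) (yes _) _ = refl
  indicator-does (no _)  (no _)  _ = refl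

  sum-allFins : ∀ {j} (f : Fin j → ℕ) → sum (map f (allFins L j)) ≡ ∑[ i < j ] f i
  sum-allFins {zero}  f = refl
  sum-allFins {suc j} f = cong (f zero +_) (begin
    sum (map f (map suc (allFins L j)))  ≡⟨ cong sum (map-∘ (allFins L j)) ⟨
    sum (map (f ∘ suc) (allFins L j))    ≡⟨ sum-allFins (f ∘ suc) ⟩
    ∑[ i < j ] f (suc i)                 ∎)
    where open ≡-Reasoning

  ∑-indicator-≟ : ∀ {j} (x : Fin j) → ∑[ v < j ] indicator L (x ≟ v) ≡ 1
  ∑-indicator-≟ {suc j} zero    = cong suc (trans (∑-const j 0) (*-zeroʳ j))
  ∑-indicator-≟ {suc j} (suc x) =
    trans (sum-cong-≗ (λ v → indicator-does (suc x ≟ suc v) (x ≟ v) refl)) (∑-indicator-≟ x)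

  outdegNormal : Orientation L → Fin n → ℕ
  outdegNormal o v = ∑[ e < m ] indicator L (from L e (o e) ≟ v)

  outdegHanging : Fin n → ℕ
  outdegHanging v = ∑[ h < k ] indicator L (hang h ≟ v)

  outdeg-split : ∀ o v → outdeg L o v ≡ outdegNormal o v + outdegHanging v
  outdeg-split o v = cong₂ _+_ (sum-allFins (λ e → indicator L (from L e (o e) ≟ v)))
                                (sum-allFins (λ h → indicator L (hang h ≟ v)))

  ∑-outdeg : ∀ o → ∑[ v < n ] outdeg L o v ≡ m + k
  ∑-outdeg o = begin
    ∑[ v < n ] outdeg L o v
      ≡⟨ sum-cong-≗ (outdeg-split o) ⟩
    ∑[ v < n ] (outdegNormal o v + outdegHanging v)
      ≡⟨ ∑-distrib-+ (outdegNormal o) outdegHanging ⟩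
    ∑[ v < n ] outdegNormal o v + ∑[ v < n ] outdegHanging v
      ≡⟨ cong₂ _+_ (∑-comm (λ v e → indicator L (from L e (o e) ≟ v)))
                   (∑-comm (λ v h → indicator L (hang h ≟ v))) ⟩
    ∑[ e < m ] ∑[ v < n ] indicator L (from L e (o e) ≟ v)
      + ∑[ h < k ] ∑[ v < n ] indicator L (hang h ≟ v)
      ≡⟨ cong₂ _+_ (sum-cong-≗ (∑-indicator-≟ ∘ λ e → from L e (o e)))
                   (sum-cong-≗ (∑-indicator-≟ ∘ hang)) ⟩
    ∑[ e < m ] 1 + ∑[ h < k ] 1
      ≡⟨ cong₂ _+_ (trans (∑-const m 1) (*-identityʳ m)) (trans (∑-const k 1) (*-identityʳ k)) ⟩
    m + k
      ∎
    where open ≡-Reasoning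

  ∑-outdeg-valid : ∀ o → Valid L o → ∑[ v < n ] outdeg L o v ≡ n * 2
  ∑-outdeg-valid o valid = trans (sum-cong-≗ valid) (∑-const n 2)

  valid⇒outdegNormal-≡ : ∀ {o o′} → Valid L o → Valid L o′ →
                         ∀ v → outdegNormal o v ≡ outdegNormal o′ v
  valid⇒outdegNormal-≡ {o} {o′} valid valid′ v = +-cancelʳ-≡ (outdegHanging v) _ _ (begin
    outdegNormal o v + outdegHanging v   ≡⟨ outdeg-split o v ⟨
    outdeg L o v                         ≡⟨ trans (valid v) (sym (valid′ v)) ⟩
    outdeg L o′ v                        ≡⟨ outdeg-split o′ v ⟩
    outdegNormal o′ v + outdegHanging v  ∎)
    where open ≡-Reasoning

module _ {n m k : ℕ} {L : Pseudograph n m k} where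
  open import Data.List.Membership.DecPropositional (_≟_ {n}) using (_∈?_)

  Directed : Orientation L → ∀ {u v} → Walk L u v → Set
  Directed o []           = ⊤
  Directed o (step e b w) = b ≡ o e × Directed o w

  prefix-Directed : ∀ {o u v x} (w : Walk L u v) (x∈ : x ∈ vertices w) →
                    Directed o w → Directed o (prefix w x∈)
  prefix-Directed w            (here refl) _          = tt
  prefix-Directed []           (there ())  _
  prefix-Directed (step e b w) (there x∈)  (b≡ , dw) = b≡ , prefix-Directed w x∈ dw

  directed-path-tail≢end : ∀ {o u x e} (p : Walk L u x) → Unique (vertices p) → Directed o p →
                           e ∈ walkEdges L p → from L e (o e) ≢ x
  directed-path-tail≢end (step e b p) (u∉ ∷ _)  (refl , _) (here refl) tail≡x =
    All¬⇒¬Any u∉ (subst (_∈ vertices p) (sym tail≡x) (end∈vertices p))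
  directed-path-tail≢end (step e b p) (_  ∷ p!) (_ , dp)   (there e∈)  =
    directed-path-tail≢end p p! dp e∈

  directed-walk-Unique : Acyclic L → ∀ {o u v} (w : Walk L u v) → Directed o w → Unique (vertices w)
  directed-walk-Unique acyclic []           _           = [] ∷ []
  directed-walk-Unique acyclic {o} (step e _ w) (refl , dw) = extend (from L e (o e) ∈? vertices w)
    where
    w! : Unique (vertices w)
    w! = directed-walk-Unique acyclic w dw
    extend : Dec (from L e (o e) ∈ vertices w) → Unique (vertices (step e (o e) w))
    extend (no  tail∉) = ¬Any⇒All¬ _ tail∉ ∷ w!
    -- e closes the prefix up to its tail into a cycle: on a directed path no edge leaves the end.
    extend (yes tail∈) = ⊥-elim (acyclic _ (step e (o e) p)
        (closing-isCycle e (o e) p p!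
          (λ e∈ → directed-path-tail≢end p p! (prefix-Directed w tail∈ dw) e∈ refl)))
      where
      p : Walk L (to L e (o e)) (from L e (o e))
      p = prefix w tail∈
      p! : Unique (vertices p)
      p! = prefix-Unique w tail∈ w!

  from-flipped : ∀ e {b c} → b ≢ c → from L e c ≡ to L e b
  from-flipped e {true}  {true}  b≢c = contradiction refl b≢c
  from-flipped e {true}  {false} _   = refl
  from-flipped e {false} {true}  _   = refl
  from-flipped e {false} {false} b≢c = contradiction refl b≢c

  module Differing (o o′ : Orientation L)
                   (same : ∀ v → Outdegree.outdegNormal L o v ≡ Outdegree.outdegNormal L o′ v) where
    open Outdegree L

    DifferingInto DifferingOutOf : Fin n → Set
    DifferingInto  v = ∃[ e ] o e ≢ o′ e × to L e (o e) ≡ v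
    DifferingOutOf v = ∃[ e ] o e ≢ o′ e × from L e (o e) ≡ v

    differing-successor : ∀ {v} → DifferingInto v → DifferingOutOf v
    differing-successor {v} (e₀ , e₀≢ , e₀↦v)
      with any? (λ e → ¬? (o e ≟ᵇ o′ e) ×-dec (from L e (o e) ≟ v))
    ... | yes found = found
    -- Otherwise e₀ makes the normal outdegree of v strictly larger under o′ than under o.
    ... | no  none  =
      ⊥-elim (<-irrefl (same v) (∑-mono-< {f = tail-v o} {g = tail-v o′} fewer e₀ more))
      where
      tail-v : Orientation L → Fin m → ℕ
      tail-v p e = indicator L (from L e (p e) ≟ v)
      fewer : ∀ e → tail-v o e ≤ tail-v o′ e
      fewer e with o e ≟ᵇ o′ e
      ... | yes eq = ≤-reflexive (cong (λ b → indicator L (from L e b ≟ v)) eq)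
      ... | no  e≢ rewrite indicator-no (from L e (o e) ≟ v) (λ tail≡v → none (e , e≢ , tail≡v))
                   = z≤n
      more : tail-v o e₀ < tail-v o′ e₀
      more rewrite indicator-no (from L e₀ (o e₀) ≟ v) (λ tail≡v → none (e₀ , e₀≢ , tail≡v))
                 | indicator-yes (from L e₀ (o′ e₀) ≟ v) (trans (from-flipped e₀ e₀≢) e₀↦v)
                 = s≤s z≤n

    long-directed-walk : ∀ t {v} → DifferingInto v →
                         ∃[ u ] Σ (Walk L v u) λ w → Directed o w × length (vertices w) ≡ suc t
    long-directed-walk zero    _    = _ , [] , tt , refl
    long-directed-walk (suc t) into with differing-successor into
    ... | e , e≢ , refl with long-directed-walk t (e , e≢ , refl)
    ...   | u , w , dw , len = u , step e (o e) w , (refl , dw) , cong suc len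

  valid-orientation-unique : Acyclic L → ∀ {o o′} → Valid L o → Valid L o′ → o ≗ o′
  valid-orientation-unique acyclic {o} {o′} valid valid′ e =
    decidable-stable (o e ≟ᵇ o′ e) λ e≢ →
      let _ , w , dw , len = long-directed-walk n (e , e≢ , refl)
      in 1+n≰n (subst (_≤ n) len (Unique⇒length≤ (directed-walk-Unique acyclic w dw)))
    where open Differing o o′ (Outdegree.valid⇒outdegNormal-≡ L {o} {o′} valid valid′)

length-filter≤1 : ∀ {A : Set} {P : A → Set} (P? : Decidable P) {xs : List A} →
                  AllPairs (λ x y → P x → ¬ P y) xs → length (filter P? xs) ≤ 1
length-filter≤1 P? {[]}     []      = z≤n
length-filter≤1 P? {x ∷ xs} (x⊥ ∷ xs⊥) with P? x
... | yes px = s≤s (≤-reflexive (cong length (filter-none P? (All.map (λ r → r px) x⊥))))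
... | no  _  = length-filter≤1 P? xs⊥

allOrientations-distinct : ∀ j → AllPairs (λ f g → ¬ f ≗ g) (allOrientations j)
allOrientations-distinct zero    = [] ∷ []
allOrientations-distinct (suc j) =
  AllPairsₚ.++⁺ (AllPairsₚ.map⁺ (AllPairs.map (λ f≉g f≗g → f≉g (f≗g ∘ suc)) distinct))
                (AllPairsₚ.map⁺ (AllPairs.map (λ f≉g f≗g → f≉g (f≗g ∘ suc)) distinct))
                (Allₚ.map⁺ (All.universal (λ _ →
                  Allₚ.map⁺ (All.universal (λ _ → differ-at-zero refl refl) _)) _))
  where
  distinct : AllPairs (λ f g → ¬ f ≗ g) (allOrientations j)
  distinct = allOrientations-distinct j
  differ-at-zero : ∀ {f g : Fin (suc j) → Bool} → f zero ≡ true → g zero ≡ false → ¬ f ≗ g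
  differ-at-zero f₀≡true g₀≡false f≗g =
    contradiction (trans (sym f₀≡true) (trans (f≗g zero) g₀≡false)) λ ()

hanging-count : ∀ {n m k} → n ≡ m + 1 → n * 2 ≡ m + k → k ≡ n + 1
hanging-count {m = m} {k} refl twice = +-cancelˡ-≡ m k _ (trans (sym twice) (double m))
  where
  double : ∀ m → (m + 1) * 2 ≡ m + (m + 1 + 1)
  double = solve-∀

≤1⇒≡0⊎≡1 : ∀ {x} → x ≤ 1 → x ≡ 0 ⊎ x ≡ 1
≤1⇒≡0⊎≡1 = Sum.map₁ n<1⇒n≡0 ∘ m≤n⇒m<n∨m≡n

proposition4 : ∀ {n m k : ℕ} (L : Pseudograph n m k) → NormalIsTree L →
    (numValid L ≡ 0 ⊎ numValid L ≡ 1)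
    × (∃ (λ o → Valid L o) → k ≡ n + 1)
proposition4 {m = m} L tree@(_ , acyclic) =
    ≤1⇒≡0⊎≡1 (length-filter≤1 (valid? L) (AllPairs.map exclusive (allOrientations-distinct m)))
  , λ (o , valid) → hanging-count (tree⇒vertices≡edges+1 L tree)
                      (trans (sym (∑-outdeg-valid o valid)) (∑-outdeg o))
  where
  open Outdegree L
  exclusive : ∀ {o o′} → ¬ o ≗ o′ → Valid L o → ¬ Valid L o′
  exclusive {o} {o′} o≉o′ valid valid′ =
    o≉o′ (valid-orientation-unique acyclic {o} {o′} valid valid′)
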